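{- For any integer $\tau\ge0$ and any peelable bipartite factor graph $G$, $$T_{\rm C}(\mathsf{T}(G))\le T_{\rm C}(\mathsf{T}(\mathsf{J}^\tau(G)))+\tau.$$
   Context: Synchronous peeling: one round $\mathsf{J}$ maps a factor graph $H$ to the graph obtained by deleting all variable nodes of degree $\le1$ in $H$, all check nodes adjacent to them, and all edges incident to those checks; $\mathsf{J}^t$ is $t$ rounds. Peeling is iterated as long as the current graph has a variable node of degree $\le1$; $T_{\rm C}(H)$ is the number of rounds performed before halting, and $H$ is peelable if the process ends with the empty graph. $\mathsf{T}$ is the collapse operator: $\mathsf{T}(H)=(F_*,V_*,E_*)$ where $F_*$ is the set of checks of degree $\ge3$, $V_*$ is the set of connected components (as sets of variables, "super-nodes") of the subgraph formed by all variable nodes and the checks of degree exactly $2$, and a super-node $S$ is joined to $a\in F_*$ iff $a$ has an odd number of neighbours in $S$. -}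

module Defs where

open import Data.Bool using (Bool; true; false; not; _∧_; _∨_; if_then_else_)
open import Data.Nat using (ℕ; zero; suc; _≤ᵇ_; _≡ᵇ_; _%_; _≤_; _+_)
open import Data.List using (List; []; _∷_; length; filterᵇ; map; deduplicate; null)
open import Data.Bool.ListAction using (any)
import Data.List.Properties as LP
open import Data.List.Relation.Unary.Unique.Propositional using (Unique)
open import Data.Product using (_×_)
open import Relation.Binary.PropositionalEquality using (_≡_)
open import Relation.Binary.Definitions using (DecidableEquality)
open import Relation.Nullary.Decidable using (⌊_⌋)

-- The node sets are the
-- lists 'vars' and 'chks'; the edge set is {(c,v) | c ∈ chks, v ∈ vars, adj c v}.
record FG (V C : Set) : Set where
  constructor mkFG
  field
    vars : List V
    chks : List C
    adj  : C → V → Bool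
open FG public

-- Well-formedness: node lists have no repetitions (they represent sets).
WF : {V C : Set} → FG V C → Set
WF H = Unique (vars H) × Unique (chks H)

count : {A : Set} → (A → Bool) → List A → ℕ
count p xs = length (filterᵇ p xs)

varDeg : {V C : Set} → FG V C → V → ℕ
varDeg H v = count (λ c → adj H c v) (chks H)

chkDeg : {V C : Set} → FG V C → C → ℕ
chkDeg H c = count (λ v → adj H c v) (vars H)

isLow : {V C : Set} → FG V C → V → Bool
isLow H v = varDeg H v ≤ᵇ 1

J : {V C : Set} → FG V C → FG V C
J H = mkFG
  (filterᵇ (λ v → not (isLow H v)) (vars H))
  (filterᵇ (λ c → not (any (λ v → adj H c v ∧ isLow H v) (vars H))) (chks H))
  (adj H)

Jpow : {V C : Set} → ℕ → FG V C → FG V C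
Jpow zero    H = H
Jpow (suc t) H = J (Jpow t H)

hasLow : {V C : Set} → FG V C → Bool
hasLow H = any (isLow H) (vars H)

-- number of rounds, with fuel (each round with a low variable removes at
-- least one variable, so fuel |vars H| + 1 is always sufficient)
tcFuel : {V C : Set} → ℕ → FG V C → ℕ
tcFuel zero    H = zero
tcFuel (suc k) H = if hasLow H then suc (tcFuel k (J H)) else zero

TC : {V C : Set} → FG V C → ℕ
TC H = tcFuel (suc (length (vars H))) H

Peelable : {V C : Set} → FG V C → Set
Peelable H = (null (vars (Jpow (TC H) H)) ≡ true) × (null (chks (Jpow (TC H) H)) ≡ true)

module Collapse {V C : Set} (_≟_ : DecidableEquality V) (H : FG V C) where

  deg2 : C → Bool
  deg2 c = chkDeg H c ≡ᵇ 2

  linked : V → V → Bool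
  linked u w = any (λ c → deg2 c ∧ (adj H c u ∧ adj H c w)) (chks H)

  reach : ℕ → V → V → Bool
  reach zero    v w = ⌊ v ≟ w ⌋
  reach (suc k) v w = reach k v w ∨ any (λ u → reach k v u ∧ linked u w) (vars H)

  comp : V → List V
  comp v = filterᵇ (reach (length (vars H)) v) (vars H)

  superNodes : List (List V)
  superNodes = deduplicate (LP.≡-dec _≟_) (map comp (vars H))

  heavyChks : List C
  heavyChks = filterᵇ (λ c → 3 ≤ᵇ chkDeg H c) (chks H)

  adjT : C → List V → Bool
  adjT a S = count (adj H a) S % 2 ≡ᵇ 1

  result : FG (List V) C
  result = mkFG superNodes heavyChks adjT

Tcol : {V C : Set} → DecidableEquality V → FG V C → FG (List V) C
Tcol _≟_ H = Collapse.result _≟_ H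

-- By induction on τ it suffices to treat a single round: TC (T K) ≤ 1 + TC (T (J K)) for
-- every well-formed K (TC-collapse-J).  Peeling times are compared through simulations
-- (record Simulation): if B simulates A, then J^t B simulates J^t A for every t, and A
-- has no low variable once B has none; so if B simulates J H, then TC H ≤ 1 + TC B
-- (TC-step).  The heart of the proof (module CollapseOfPeeled) is that T (J K) simulates
-- J (T K) along S ↦ S ∖ {low variables of K}: one round of peeling never disconnects the
-- remaining variables along degree-2 checks, so the components of J K are the surviving
-- parts of the components of K, and the super-nodes and checks surviving one round in
-- T K reappear, with the same incidences, in T (J K).
module Submission where

open import Data.Bool using (Bool; T; T?; true; false; not; _∧_; _∨_)
open import Data.Bool.Properties using (not-injective; T-≡; ∧-zeroʳ; ∧-identityʳ)
open import Data.Bool.ListAction using (any)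
open import Data.Empty using (⊥; ⊥-elim)
open import Data.List using (List; []; _∷_; length; filterᵇ; map)
open import Data.List.Properties using (≡-dec; length-filter; filter-notAll; filter-none)
open import Data.List.Membership.Propositional using (_∈_; lose; find)
open import Data.List.Membership.Propositional.Properties using (∈-filter⁺; ∈-filter⁻; ∈-map⁺; ∈-map⁻; ∈-deduplicate⁺; ∈-deduplicate⁻)
open import Data.List.Relation.Unary.Any using (here; there)
open import Data.List.Relation.Unary.Any.Properties using (any⁺; any⁻)
import Data.List.Relation.Unary.All as All
open import Data.List.Relation.Unary.AllPairs.Core using (_∷_)
open import Data.List.Relation.Unary.Unique.Propositional using (Unique)
import Data.List.Relation.Unary.Unique.Propositional.Properties as Unique
open import Data.Nat using (ℕ; zero; suc; _≤ᵇ_; _≡ᵇ_; _%_; _≤_; _<_; _+_; z≤n; s≤s)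
open import Data.Nat.Properties using (module ≤-Reasoning; ≤-reflexive; ≤-refl; ≤-trans; ≤-pred; <-irrefl; n≤1+n; m≤n⇒m≤1+n; +-identityʳ; +-suc; +-monoˡ-≤)
import Data.Product as Prod
open import Data.Product using (Σ; _×_; _,_; proj₁; proj₂)
open import Data.Sum using (_⊎_; inj₁; inj₂)
open import Function using (_∘_; id)
open import Function.Bundles using (Equivalence)
open import Relation.Binary.Definitions using (DecidableEquality)
open import Relation.Binary.PropositionalEquality using (_≡_; refl; sym; trans; cong; cong₂; subst; module ≡-Reasoning)
open import Relation.Nullary using (¬_; yes; no)
open import Relation.Nullary.Decidable using (⌊_⌋; dec-true; isYes≗does)
open import Defs

private variable A : Set

clash : {b : Bool} → b ≡ true → b ≡ false → ⊥
clash refl ()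

∧-elim : {a b : Bool} → (a ∧ b) ≡ true → (a ≡ true) × (b ≡ true)
∧-elim {true} {true} _ = refl , refl

∧-intro : {a b : Bool} → a ≡ true → b ≡ true → (a ∧ b) ≡ true
∧-intro refl refl = refl

∨-elim : {a b : Bool} → (a ∨ b) ≡ true → (a ≡ true) ⊎ (b ≡ true)
∨-elim {true} _ = inj₁ refl
∨-elim {false} e = inj₂ e

∨-introˡ : {a b : Bool} → a ≡ true → (a ∨ b) ≡ true
∨-introˡ refl = refl

∨-introʳ : {a b : Bool} → b ≡ true → (a ∨ b) ≡ true
∨-introʳ {true} _ = refl
∨-introʳ {false} e = e

not-elim : {b : Bool} → not b ≡ true → b ≡ false
not-elim = not-injective

not-intro : {b : Bool} → b ≡ false → not b ≡ true
not-intro = cong not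

bool-ext : {a b : Bool} → (a ≡ true → b ≡ true) → (b ≡ true → a ≡ true) → a ≡ b
bool-ext {false} {false} _ _ = refl
bool-ext {false} {true} _ g = g refl
bool-ext {true} {false} f _ = sym (f refl)
bool-ext {true} {true} _ _ = refl

≤ᵇ1-false⇒2≤ : (n : ℕ) → (n ≤ᵇ 1) ≡ false → 2 ≤ n
≤ᵇ1-false⇒2≤ (suc (suc n)) _ = s≤s (s≤s z≤n)

2≤⇒≤ᵇ1-false : (n : ℕ) → 2 ≤ n → (n ≤ᵇ 1) ≡ false
2≤⇒≤ᵇ1-false (suc (suc n)) _ = refl
2≤⇒≤ᵇ1-false (suc zero) (s≤s ())

≤ᵇ1-true⇒≤1 : (n : ℕ) → (n ≤ᵇ 1) ≡ true → n ≤ 1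
≤ᵇ1-true⇒≤1 zero _ = z≤n
≤ᵇ1-true⇒≤1 (suc zero) _ = s≤s z≤n

≡ᵇ2⇒≡2 : (n : ℕ) → (n ≡ᵇ 2) ≡ true → n ≡ 2
≡ᵇ2⇒≡2 (suc (suc zero)) _ = refl

heavy⇒not-deg2 : (n : ℕ) → (3 ≤ᵇ n) ≡ true → (n ≡ᵇ 2) ≡ true → ⊥
heavy⇒not-deg2 (suc (suc (suc n))) _ ()

odd⇒pos : (n : ℕ) → (n % 2 ≡ᵇ 1) ≡ true → 1 ≤ n
odd⇒pos (suc n) _ = s≤s z≤n

∈-filterᵇ⁻ : (p : A → Bool) {xs : List A} {x : A} → x ∈ filterᵇ p xs → (x ∈ xs) × (p x ≡ true)
∈-filterᵇ⁻ p m = Prod.map₂ (Equivalence.to T-≡) (∈-filter⁻ (T? ∘ p) m)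

∈-filterᵇ⁺ : (p : A → Bool) {xs : List A} {x : A} → x ∈ xs → p x ≡ true → x ∈ filterᵇ p xs
∈-filterᵇ⁺ p m px = ∈-filter⁺ (T? ∘ p) m (Equivalence.from T-≡ px)

any-witness : (p : A → Bool) (xs : List A) → any p xs ≡ true → Σ A λ x → (x ∈ xs) × (p x ≡ true)
any-witness p xs e = Prod.map₂ (Prod.map₂ (Equivalence.to T-≡)) (find (any⁻ p xs (Equivalence.from T-≡ e)))

any-intro : (p : A → Bool) {xs : List A} {x : A} → x ∈ xs → p x ≡ true → any p xs ≡ true
any-intro p m px = Equivalence.to T-≡ (any⁺ p (lose m (Equivalence.from T-≡ px)))

any-false-elim : (p : A → Bool) {xs : List A} {x : A} → any p xs ≡ false → x ∈ xs → p x ≡ false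
any-false-elim p {x = x} e m with p x in px
... | false = refl
... | true = ⊥-elim (clash (any-intro p m px) e)

any-false-intro : (p : A → Bool) (xs : List A) → (∀ {x} → x ∈ xs → p x ≡ false) → any p xs ≡ false
any-false-intro p [] h = refl
any-false-intro p (y ∷ ys) h rewrite h (here refl) = any-false-intro p ys (λ m → h (there m))

count≤length : (p : A → Bool) (xs : List A) → count p xs ≤ length xs
count≤length p = length-filter (T? ∘ p)

count-≥1 : (p : A → Bool) {xs : List A} {x : A} → x ∈ xs → p x ≡ true → 1 ≤ count p xs
count-≥1 p {y ∷ ys} (here refl) px rewrite px = s≤s z≤n
count-≥1 p {y ∷ ys} (there m) px with p y
... | true = s≤s z≤n
... | false = count-≥1 p m px

count-≥1⁻ : (p : A → Bool) (xs : List A) → 1 ≤ count p xs → Σ A λ x → (x ∈ xs) × (p x ≡ true)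
count-≥1⁻ p (y ∷ ys) c with p y in py
... | true = y , here refl , py
... | false = Prod.map₂ (Prod.map₁ there) (count-≥1⁻ p ys c)

count-≥2 : (p : A → Bool) {xs : List A} {a b : A} → a ∈ xs → b ∈ xs → ¬ a ≡ b →
  p a ≡ true → p b ≡ true → 2 ≤ count p xs
count-≥2 p {y ∷ ys} (here refl) (here refl) a≢b pa pb = ⊥-elim (a≢b refl)
count-≥2 p {y ∷ ys} (here refl) (there mb) a≢b pa pb rewrite pa = s≤s (count-≥1 p mb pb)
count-≥2 p {y ∷ ys} (there ma) (here refl) a≢b pa pb rewrite pb = s≤s (count-≥1 p ma pa)
count-≥2 p {y ∷ ys} (there ma) (there mb) a≢b pa pb with p y
... | true = m≤n⇒m≤1+n (count-≥2 p ma mb a≢b pa pb)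
... | false = count-≥2 p ma mb a≢b pa pb

count-≥3 : (p : A → Bool) {xs : List A} {a b c : A} → a ∈ xs → b ∈ xs → c ∈ xs →
  ¬ a ≡ b → ¬ a ≡ c → ¬ b ≡ c → p a ≡ true → p b ≡ true → p c ≡ true → 3 ≤ count p xs
count-≥3 p {y ∷ ys} (here refl) (here refl) _ a≢b _ _ _ _ _ = ⊥-elim (a≢b refl)
count-≥3 p {y ∷ ys} (here refl) _ (here refl) _ a≢c _ _ _ _ = ⊥-elim (a≢c refl)
count-≥3 p {y ∷ ys} _ (here refl) (here refl) _ _ b≢c _ _ _ = ⊥-elim (b≢c refl)
count-≥3 p {y ∷ ys} (here refl) (there mb) (there mc) _ _ b≢c pa pb pc rewrite pa =
  s≤s (count-≥2 p mb mc b≢c pb pc)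
count-≥3 p {y ∷ ys} (there ma) (here refl) (there mc) _ a≢c _ pa pb pc rewrite pb =
  s≤s (count-≥2 p ma mc a≢c pa pc)
count-≥3 p {y ∷ ys} (there ma) (there mb) (here refl) a≢b _ _ pa pb pc rewrite pc =
  s≤s (count-≥2 p ma mb a≢b pa pb)
count-≥3 p {y ∷ ys} (there ma) (there mb) (there mc) a≢b a≢c b≢c pa pb pc with p y
... | true = m≤n⇒m≤1+n (count-≥3 p ma mb mc a≢b a≢c b≢c pa pb pc)
... | false = count-≥3 p ma mb mc a≢b a≢c b≢c pa pb pc

count-≥2⁻ : (p : A → Bool) (xs : List A) → Unique xs → 2 ≤ count p xs →
  Σ A λ a → Σ A λ b → (a ∈ xs) × (b ∈ xs) × (¬ a ≡ b) × (p a ≡ true) × (p b ≡ true)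
count-≥2⁻ p (y ∷ ys) (y∉ys ∷ u) c with p y in py
... | true = let (x , mx , px) = count-≥1⁻ p ys (≤-pred c) in
  y , x , here refl , there mx , All.lookup y∉ys mx , py , px
... | false = let (a , b , ma , mb , a≢b , pa , pb) = count-≥2⁻ p ys u c in
  a , b , there ma , there mb , a≢b , pa , pb

count≤1⇒unique : (p : A → Bool) {xs : List A} {a b : A} → count p xs ≤ 1 →
  a ∈ xs → b ∈ xs → p a ≡ true → p b ≡ true → a ≡ b
count≤1⇒unique p {y ∷ ys} c (here refl) (here refl) pa pb = refl
count≤1⇒unique p {y ∷ ys} c (here refl) (there mb) pa pb rewrite pa =
  ⊥-elim (<-irrefl refl (≤-trans (s≤s (count-≥1 p mb pb)) c))
count≤1⇒unique p {y ∷ ys} c (there ma) (here refl) pa pb rewrite pb =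
  ⊥-elim (<-irrefl refl (≤-trans (s≤s (count-≥1 p ma pa)) c))
count≤1⇒unique p {y ∷ ys} c (there ma) (there mb) pa pb with p y
... | true = count≤1⇒unique p (≤-trans (n≤1+n _) c) ma mb pa pb
... | false = count≤1⇒unique p c ma mb pa pb

count-mono : (p q : A → Bool) (xs : List A) →
  (∀ {x} → x ∈ xs → p x ≡ true → q x ≡ true) → count p xs ≤ count q xs
count-mono p q [] p⇒q = z≤n
count-mono p q (y ∷ ys) p⇒q with p y in py | q y in qy
... | true | true = s≤s (count-mono p q ys (p⇒q ∘ there))
... | true | false = ⊥-elim (clash (p⇒q (here refl) py) qy)
... | false | true = m≤n⇒m≤1+n (count-mono p q ys (p⇒q ∘ there))
... | false | false = count-mono p q ys (p⇒q ∘ there)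

count-mono-< : (p q : A → Bool) (xs : List A) → (∀ {x} → x ∈ xs → p x ≡ true → q x ≡ true) →
  {z : A} → z ∈ xs → q z ≡ true → p z ≡ false → count p xs < count q xs
count-mono-< p q (y ∷ ys) p⇒q (here refl) qz pz rewrite qz | pz = s≤s (count-mono p q ys (p⇒q ∘ there))
count-mono-< p q (y ∷ ys) p⇒q (there m) qz pz with p y in py | q y in qy
... | true | true = s≤s (count-mono-< p q ys (p⇒q ∘ there) m qz pz)
... | true | false = ⊥-elim (clash (p⇒q (here refl) py) qy)
... | false | true = m≤n⇒m≤1+n (count-mono-< p q ys (p⇒q ∘ there) m qz pz)
... | false | false = count-mono-< p q ys (p⇒q ∘ there) m qz pz

filter-filter : (p q : A → Bool) (xs : List A) →
  filterᵇ p (filterᵇ q xs) ≡ filterᵇ (λ x → q x ∧ p x) xs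
filter-filter p q [] = refl
filter-filter p q (y ∷ ys) with q y
... | false = filter-filter p q ys
... | true with p y
... | true = cong (y ∷_) (filter-filter p q ys)
... | false = filter-filter p q ys

count-filter : (p q : A → Bool) (xs : List A) → count p (filterᵇ q xs) ≡ count (λ x → q x ∧ p x) xs
count-filter p q xs = cong length (filter-filter p q xs)

filter-cong : (p q : A → Bool) (xs : List A) → (∀ {x} → x ∈ xs → p x ≡ q x) → filterᵇ p xs ≡ filterᵇ q xs
filter-cong p q [] p≡q = refl
filter-cong p q (y ∷ ys) p≡q with p y | q y | p≡q (here refl)
... | true | true | refl = cong (y ∷_) (filter-cong p q ys (p≡q ∘ there))
... | false | false | refl = filter-cong p q ys (p≡q ∘ there)

count-cong : (p q : A → Bool) (xs : List A) → (∀ {x} → x ∈ xs → p x ≡ q x) → count p xs ≡ count q xs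
count-cong p q xs p≡q = cong length (filter-cong p q xs p≡q)

count-filter-single : (p q : A → Bool) {xs : List A} {u : A} → Unique xs → u ∈ xs → p u ≡ true →
  (∀ {x} → x ∈ xs → p x ≡ true → x ≡ u) → q u ≡ true → count q (filterᵇ p xs) ≡ 1
count-filter-single p q {y ∷ ys} (y∉ys ∷ _) (here refl) pu only-u qu rewrite pu | qu =
  cong (suc ∘ count q) (filter-none (T? ∘ p) (All.tabulate rejected))
  where
  rejected : ∀ {x} → x ∈ ys → ¬ T (p x)
  rejected m px = All.lookup y∉ys m (sym (only-u (there m) (Equivalence.to T-≡ px)))
count-filter-single p q {y ∷ ys} (y∉ys ∷ u) (there mu) pu only-u qu with p y in py
... | true = ⊥-elim (All.lookup y∉ys mu (only-u (here refl) py))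
... | false = count-filter-single p q u mu pu (only-u ∘ there) qu

hasLowNbr : {X C : Set} → FG X C → C → Bool
hasLowNbr H c = any (λ v → adj H c v ∧ isLow H v) (vars H)

module Peeling {X C : Set} (H : FG X C) where

  J-var⁻ : ∀ {x} → x ∈ vars (J H) → (x ∈ vars H) × (isLow H x ≡ false)
  J-var⁻ m = Prod.map₂ not-elim (∈-filterᵇ⁻ _ m)

  J-var⁺ : ∀ {x} → x ∈ vars H → isLow H x ≡ false → x ∈ vars (J H)
  J-var⁺ m l = ∈-filterᵇ⁺ (not ∘ isLow H) m (not-intro l)

  J-chk⁻ : ∀ {c} → c ∈ chks (J H) → (c ∈ chks H) × (hasLowNbr H c ≡ false)
  J-chk⁻ m = Prod.map₂ not-elim (∈-filterᵇ⁻ _ m)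

  J-chk⁺ : ∀ {c} → c ∈ chks H → hasLowNbr H c ≡ false → c ∈ chks (J H)
  J-chk⁺ m r = ∈-filterᵇ⁺ (not ∘ hasLowNbr H) m (not-intro r)

  J-vars⊆ : ∀ {x} → x ∈ vars (J H) → x ∈ vars H
  J-vars⊆ = proj₁ ∘ J-var⁻

  J-chks⊆ : ∀ {c} → c ∈ chks (J H) → c ∈ chks H
  J-chks⊆ = proj₁ ∘ J-chk⁻

  J-chks-unique : Unique (chks H) → Unique (chks (J H))
  J-chks-unique = Unique.filter⁺ _

  nbr-not-low : ∀ {c x} → hasLowNbr H c ≡ false → x ∈ vars H → adj H c x ≡ true → isLow H x ≡ false
  nbr-not-low {c} {x} r m a with isLow H x in l
  ... | false = refl
  ... | true = ⊥-elim (clash (any-intro (λ v → adj H c v ∧ isLow H v) m (∧-intro a l)) r)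

  no-low-nbr : ∀ {c} → (∀ {x} → x ∈ vars H → adj H c x ≡ true → isLow H x ≡ false) → hasLowNbr H c ≡ false
  no-low-nbr {c} nbrs = any-false-intro _ (vars H) λ {x} m → not-both (nbrs m)
    where
    not-both : ∀ {x} → (adj H c x ≡ true → isLow H x ≡ false) → (adj H c x ∧ isLow H x) ≡ false
    not-both {x} g with adj H c x
    ... | false = refl
    ... | true = g refl

  J-shrinks : hasLow H ≡ true → length (vars (J H)) < length (vars H)
  J-shrinks h = let (_ , m , l) = any-witness (isLow H) (vars H) h in
    filter-notAll (T? ∘ not ∘ isLow H) (vars H) (lose m (λ t → subst (T ∘ not) l t))

open Peeling

Jpow-J : {X C : Set} (t : ℕ) (H : FG X C) → Jpow t (J H) ≡ J (Jpow t H)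
Jpow-J zero H = refl
Jpow-J (suc t) H = cong J (Jpow-J t H)

tcFuel-≤ : {X C : Set} (k t : ℕ) (H : FG X C) → hasLow (Jpow t H) ≡ false → tcFuel k H ≤ t
tcFuel-≤ zero t H h = z≤n
tcFuel-≤ (suc k) zero H h rewrite h = z≤n
tcFuel-≤ (suc k) (suc t) H h with hasLow H
... | false = z≤n
... | true = s≤s (tcFuel-≤ k t (J H) (subst (λ G → hasLow G ≡ false) (sym (Jpow-J t H)) h))

tcFuel-halts : {X C : Set} (k : ℕ) (H : FG X C) → length (vars H) < k → hasLow (Jpow (tcFuel k H) H) ≡ false
tcFuel-halts (suc k) H n<k with hasLow H in h
... | false = h
... | true = subst (λ G → hasLow G ≡ false) (Jpow-J (tcFuel k (J H)) H)
               (tcFuel-halts k (J H) (≤-trans (J-shrinks H h) (≤-pred n<k)))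

-- Checks of A are checks of B, variables of A
-- are sent into B with the same incidences, and conversely B adds nothing A would
-- have to wait for: every non-low variable of B, and every B-neighbour of a check of A,
-- comes from A, and every check of B without a low neighbour is already a check of A.
-- Simulations survive a round of peeling on both sides (sim-J), and when B stops
-- A stops too (sim-halts); hence A needs no more rounds than B (TC-step).
record Simulation {X Y C : Set} (A : FG X C) (B : FG Y C) (f : X → Y) : Set where
  field
    chksA-unique : Unique (chks A)
    chksB-unique : Unique (chks B)
    var-map : ∀ {x} → x ∈ vars A → f x ∈ vars B
    chk-incl : ∀ {c} → c ∈ chks A → c ∈ chks B
    adj-pres : ∀ {c x} → c ∈ chks A → x ∈ vars A → adj A c x ≡ adj B c (f x)
    nbr-image : ∀ {c y} → c ∈ chks A → y ∈ vars B → adj B c y ≡ true →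
      Σ X λ x → (x ∈ vars A) × (f x ≡ y)
    nonlow-image : ∀ {y} → y ∈ vars B → isLow B y ≡ false → Σ X λ x → (x ∈ vars A) × (f x ≡ y)
    quiet-chk-incl : ∀ {c} → c ∈ chks B → hasLowNbr B c ≡ false → c ∈ chks A

module _ {X Y C : Set} {A : FG X C} {B : FG Y C} {f : X → Y} (S : Simulation A B f) where
  open Simulation S

  nonlow-pres : ∀ {x} → x ∈ vars A → isLow A x ≡ false → isLow B (f x) ≡ false
  nonlow-pres {x} m l =
    let (_ , _ , ma , mb , a≢b , pa , pb) = count-≥2⁻ (λ c → adj A c x) (chks A) chksA-unique (≤ᵇ1-false⇒2≤ _ l)
    in 2≤⇒≤ᵇ1-false _ (count-≥2 (λ c → adj B c (f x)) (chk-incl ma) (chk-incl mb) a≢b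
         (trans (sym (adj-pres ma m)) pa) (trans (sym (adj-pres mb m)) pb))

  nonlow-reflect : ∀ {x} (cs : List C) → Unique cs → (∀ {c} → c ∈ cs → adj B c (f x) ≡ true → c ∈ chks A) →
    2 ≤ count (λ c → adj B c (f x)) cs → x ∈ vars A → isLow A x ≡ false
  nonlow-reflect {x} cs u inA two m =
    let (_ , _ , ma , mb , a≢b , pa , pb) = count-≥2⁻ (λ c → adj B c (f x)) cs u two
        ma' = inA ma pa ; mb' = inA mb pb
    in 2≤⇒≤ᵇ1-false _ (count-≥2 (λ c → adj A c x) ma' mb' a≢b
         (trans (adj-pres ma' m) pa) (trans (adj-pres mb' m) pb))

  nonlow-reflect-J : ∀ {x} → x ∈ vars A → isLow (J B) (f x) ≡ false → isLow A x ≡ false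
  nonlow-reflect-J mx l = nonlow-reflect (chks (J B)) (J-chks-unique B chksB-unique)
    (λ mc _ → let (mcB , r) = J-chk⁻ B mc in quiet-chk-incl mcB r) (≤ᵇ1-false⇒2≤ _ l) mx

  sim-halts : hasLow B ≡ false → hasLow A ≡ false
  sim-halts noLowB = any-false-intro (isLow A) (vars A) λ {x} m →
    nonlow-reflect (chks B) chksB-unique
      (λ mc _ → quiet-chk-incl mc (no-low-nbr B λ my _ → any-false-elim (isLow B) noLowB my))
      (≤ᵇ1-false⇒2≤ _ (any-false-elim (isLow B) noLowB (var-map m))) m

  nbr-preimage : ∀ {c y} → c ∈ chks A → y ∈ vars B → adj B c y ≡ true →
    Σ X λ x → (x ∈ vars A) × (f x ≡ y) × (adj A c x ≡ true)
  nbr-preimage {c} mc my a with nbr-image mc my a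
  ... | (x , mx , refl) = x , mx , refl , trans (adj-pres mc mx) a

  sim-J : Simulation (J A) (J B) f
  sim-J = record
    { chksA-unique = J-chks-unique A chksA-unique
    ; chksB-unique = J-chks-unique B chksB-unique
    ; var-map = λ m → let (mA , l) = J-var⁻ A m in J-var⁺ B (var-map mA) (nonlow-pres mA l)
    ; chk-incl = chk-incl-J
    ; adj-pres = λ mc mx → adj-pres (J-chks⊆ A mc) (J-vars⊆ A mx)
    ; nbr-image = nbr-image-J
    ; nonlow-image = nonlow-image-J
    ; quiet-chk-incl = quiet-chk-incl-J
    }
    where
    chk-incl-J : ∀ {c} → c ∈ chks (J A) → c ∈ chks (J B)
    chk-incl-J mc = let (mA , r) = J-chk⁻ A mc in
      J-chk⁺ B (chk-incl mA) (no-low-nbr B λ my a →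
        let (x , mx , fx≡y , ax) = nbr-preimage mA my a in
        subst (λ y → isLow B y ≡ false) fx≡y (nonlow-pres mx (nbr-not-low A r mx ax)))

    nbr-image-J : ∀ {c y} → c ∈ chks (J A) → y ∈ vars (J B) → adj (J B) c y ≡ true →
      Σ X λ x → (x ∈ vars (J A)) × (f x ≡ y)
    nbr-image-J mc my a = let (mA , r) = J-chk⁻ A mc
                              (x , mx , fx≡y , ax) = nbr-preimage mA (J-vars⊆ B my) a in
      x , J-var⁺ A mx (nbr-not-low A r mx ax) , fx≡y

    nonlow-image-J : ∀ {y} → y ∈ vars (J B) → isLow (J B) y ≡ false → Σ X λ x → (x ∈ vars (J A)) × (f x ≡ y)
    nonlow-image-J my l = let (myB , lB) = J-var⁻ B my
                              (x , mx , fx≡y) = nonlow-image myB lB in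
      x , J-var⁺ A mx (nonlow-reflect-J mx (subst (λ y → isLow (J B) y ≡ false) (sym fx≡y) l)) , fx≡y

    quiet-chk-incl-J : ∀ {c} → c ∈ chks (J B) → hasLowNbr (J B) c ≡ false → c ∈ chks (J A)
    quiet-chk-incl-J mc r = let (mcB , rB) = J-chk⁻ B mc ; mcA = quiet-chk-incl mcB rB in
      J-chk⁺ A mcA (no-low-nbr A λ mx a →
        let a' = trans (sym (adj-pres mcA mx)) a
            fx∈JB = J-var⁺ B (var-map mx) (nbr-not-low B rB (var-map mx) a')
        in nonlow-reflect-J mx (nbr-not-low (J B) r fx∈JB a'))

sim-Jpow : {X Y C : Set} {A : FG X C} {B : FG Y C} {f : X → Y} →
  Simulation A B f → (t : ℕ) → Simulation (Jpow t A) (Jpow t B) f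
sim-Jpow S zero = S
sim-Jpow S (suc t) = sim-J (sim-Jpow S t)

TC-step : {X Y C : Set} (H : FG X C) (B : FG Y C) (f : X → Y) → Simulation (J H) B f → TC H ≤ suc (TC B)
TC-step H B f S = tcFuel-≤ (suc (length (vars H))) (suc (TC B)) H
  (subst (λ G → hasLow G ≡ false) (Jpow-J (TC B) H)
    (sim-halts (sim-Jpow S (TC B)) (tcFuel-halts (suc (length (vars B))) B ≤-refl)))

-- Reachability along degree-2 checks, as computed by Collapse.reach.  The Boolean
-- reach k v w is wrapped in a record so that k, v and w stay visible to unification.
module Reachability {V C : Set} (_≟_ : DecidableEquality V) (M : FG V C) where
  open Collapse _≟_ M

  record Reach (k : ℕ) (v w : V) : Set where
    constructor mkReach
    field reach-true : reach k v w ≡ true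
  open Reach public

  Reachable : V → V → Set
  Reachable v w = Σ ℕ λ k → Reach k v w

  reach-zero : ∀ {v w} → Reach zero v w → v ≡ w
  reach-zero (mkReach e) = ≟-sound e
    where
    ≟-sound : ∀ {v w} → ⌊ v ≟ w ⌋ ≡ true → v ≡ w
    ≟-sound {v} {w} e with v ≟ w
    ... | yes v≡w = v≡w

  reach-weaken : ∀ {k v w} → Reach k v w → Reach (suc k) v w
  reach-weaken (mkReach e) = mkReach (∨-introˡ e)

  reach-extend : ∀ {k v u w} → Reach k v u → u ∈ vars M → linked u w ≡ true → Reach (suc k) v w
  reach-extend {k} {v} {w = w} (mkReach r) mu l =
    mkReach (∨-introʳ {reach k v w} (any-intro (λ x → reach k v x ∧ linked x w) mu (∧-intro r l)))

  reach-last : ∀ {k v w} → Reach (suc k) v w →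
    Reach k v w ⊎ (Σ V λ u → (u ∈ vars M) × Reach k v u × (linked u w ≡ true))
  reach-last {k} {v} {w} (mkReach e) with ∨-elim {reach k v w} e
  ... | inj₁ e₁ = inj₁ (mkReach e₁)
  ... | inj₂ e₂ = let (u , mu , q) = any-witness (λ x → reach k v x ∧ linked x w) (vars M) e₂
                      (r , l) = ∧-elim q in
    inj₂ (u , mu , mkReach r , l)

  reach-mono : ∀ {k m v w} → k ≤ m → Reach k v w → Reach m v w
  reach-mono {zero} {zero} _ r = r
  reach-mono {zero} {suc m} _ r = reach-weaken (reach-mono {zero} {m} z≤n r)
  reach-mono {suc k} {suc m} (s≤s k≤m) r with reach-last r
  ... | inj₁ r₁ = reach-weaken (reach-mono k≤m r₁)
  ... | inj₂ (u , mu , r₁ , l) = reach-extend (reach-mono k≤m r₁) mu l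

  reach-refl : ∀ k v → Reach k v v
  reach-refl k v = reach-mono {zero} {k} z≤n (mkReach (trans (isYes≗does (v ≟ v)) (dec-true (v ≟ v) refl)))

  -- Stabilisation: once one more step reaches nothing new from v, nothing new is ever
  -- reached; as every new step adds a variable, this happens within |vars M| steps.
  Saturated : V → ℕ → Set
  Saturated v k = ∀ {u} → u ∈ vars M → Reach (suc k) v u → Reach k v u

  saturated-step : ∀ {v k w} → Saturated v k → Reach (suc (suc k)) v w → Reach (suc k) v w
  saturated-step sat r with reach-last r
  ... | inj₁ r₁ = r₁
  ... | inj₂ (u , mu , r₁ , l) = reach-extend (sat mu r₁) mu l

  saturated-all : ∀ {v k} → Saturated v k → ∀ m {w} → Reach m v w → Reach (suc k) v w
  saturated-all sat zero r = reach-mono z≤n r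
  saturated-all sat (suc m) r with reach-last r
  ... | inj₁ r₁ = saturated-all sat m r₁
  ... | inj₂ (u , mu , r₁ , l) = saturated-step sat (reach-extend (saturated-all sat m r₁) mu l)

  saturates-or-grows : ∀ {v} → v ∈ vars M → ∀ k →
    (Σ ℕ λ j → (j < k) × Saturated v j) ⊎ (k < count (reach k v) (vars M))
  saturates-or-grows mv zero = inj₂ (count-≥1 _ mv (reach-true (reach-refl zero _)))
  saturates-or-grows {v} mv (suc k) with saturates-or-grows mv k
  ... | inj₁ (j , j<k , sat) = inj₁ (j , ≤-trans j<k (n≤1+n _) , sat)
  ... | inj₂ k<N with any (λ u → reach (suc k) v u ∧ not (reach k v u)) (vars M) in new
  ... | false = inj₁ (k , ≤-refl , λ mu r →
    mkReach (not-new (any-false-elim (λ u → reach (suc k) v u ∧ not (reach k v u)) new mu) (reach-true r)))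
    where
    not-new : ∀ {a b : Bool} → (b ∧ not a) ≡ false → b ≡ true → a ≡ true
    not-new {true} _ _ = refl
    not-new {false} {true} () _
  ... | true = let (_ , mu , q) = any-witness _ (vars M) new ; (r₁ , r₀) = ∧-elim q in
    inj₂ (≤-trans (s≤s k<N) (count-mono-< (reach k v) (reach (suc k) v) (vars M)
      (λ _ e → reach-true (reach-weaken {k} {v} (mkReach e))) mu r₁ (not-elim r₀)))

  reach-stable : ∀ {v w} → v ∈ vars M → ∀ m → Reach m v w → Reach (length (vars M)) v w
  reach-stable mv m r with saturates-or-grows mv (length (vars M))
  ... | inj₁ (j , j<n , sat) = reach-mono j<n (saturated-all sat m r)
  ... | inj₂ n<N = ⊥-elim (<-irrefl refl (≤-trans n<N (count≤length _ (vars M))))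

  linked-sym : ∀ {u w} → linked u w ≡ true → linked w u ≡ true
  linked-sym {u} {w} e =
    let (c , mc , q) = any-witness (λ c → deg2 c ∧ (adj M c u ∧ adj M c w)) (chks M) e
        (d , a) = ∧-elim {deg2 c} q ; (au , aw) = ∧-elim {adj M c u} a
    in any-intro (λ c → deg2 c ∧ (adj M c w ∧ adj M c u)) mc (∧-intro d (∧-intro aw au))

  reach-prepend : ∀ {w u v} → w ∈ vars M → linked w u ≡ true → ∀ k → Reach k u v → Reach (suc k) w v
  reach-prepend {w} mw l zero r with reach-zero r
  ... | refl = reach-extend (reach-refl zero w) mw l
  reach-prepend mw l (suc k) r with reach-last r
  ... | inj₁ r₁ = reach-weaken (reach-prepend mw l k r₁)
  ... | inj₂ (u , mu , r₁ , l₁) = reach-extend (reach-prepend mw l k r₁) mu l₁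

  reach-sym : ∀ {v w} → w ∈ vars M → ∀ k → Reach k v w → Reachable w v
  reach-sym mw zero r with reach-zero r
  ... | refl = zero , reach-refl zero _
  reach-sym mw (suc k) r with reach-last r
  ... | inj₁ r₁ = reach-sym mw k r₁
  ... | inj₂ (u , mu , r₁ , l) = let (k′ , r′) = reach-sym mu k r₁ in
    suc k′ , reach-prepend mw (linked-sym l) k′ r′

  reach-trans : ∀ {v u w} a → Reach a v u → ∀ b → Reach b u w → Reach (b + a) v w
  reach-trans a r zero r′ with reach-zero r′
  ... | refl = r
  reach-trans a r (suc b) r′ with reach-last r′
  ... | inj₁ r₁ = reach-weaken (reach-trans a r b r₁)
  ... | inj₂ (u , mu , r₁ , l) = reach-extend (reach-trans a r b r₁) mu l

  comp-∈⁻ : ∀ {v x} → x ∈ comp v → (x ∈ vars M) × Reach (length (vars M)) v x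
  comp-∈⁻ m = Prod.map₂ mkReach (∈-filterᵇ⁻ _ m)

  comp-∋-self : ∀ {v} → v ∈ vars M → v ∈ comp v
  comp-∋-self {v} mv = ∈-filterᵇ⁺ _ mv (reach-true (reach-refl (length (vars M)) v))

  comp-≡ : ∀ {v w} → v ∈ vars M → w ∈ vars M → Reach (length (vars M)) v w → comp v ≡ comp w
  comp-≡ mv mw r = filter-cong _ _ (vars M) λ _ →
    bool-ext (λ e → reach-true (reach-stable mw _ (reach-trans _ (proj₂ (reach-sym mw _ r)) n (mkReach e))))
             (λ e → reach-true (reach-stable mv _ (reach-trans n r n (mkReach e))))
    where
    n : ℕ
    n = length (vars M)

  isolated-target : ∀ {u} → (∀ z → linked z u ≡ false) → ∀ k {v} → Reach k v u → v ≡ u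
  isolated-target iso zero r = reach-zero r
  isolated-target iso (suc k) r with reach-last r
  ... | inj₁ r₁ = isolated-target iso k r₁
  ... | inj₂ (u′ , _ , _ , l) = ⊥-elim (clash l (iso u′))

  isolated-source : ∀ {u} → (∀ z → linked u z ≡ false) → ∀ k {x} → Reach k u x → x ≡ u
  isolated-source iso zero r = sym (reach-zero r)
  isolated-source {u} iso (suc k) r with reach-last r
  ... | inj₁ r₁ = isolated-source iso k r₁
  ... | inj₂ (u′ , _ , r₁ , l) with isolated-source iso k r₁
  ... | refl = ⊥-elim (clash l (iso _))

  superNode⁻ : ∀ {S} → S ∈ superNodes → Σ V λ v → (v ∈ vars M) × (S ≡ comp v)
  superNode⁻ m = ∈-map⁻ comp (∈-deduplicate⁻ (≡-dec _≟_) (map comp (vars M)) m)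

  superNode⁺ : ∀ {v} → v ∈ vars M → comp v ∈ superNodes
  superNode⁺ mv = ∈-deduplicate⁺ (≡-dec _≟_) (∈-map⁺ comp mv)

  superNode⊆ : ∀ {S} → S ∈ superNodes → ∀ {x} → x ∈ S → x ∈ vars M
  superNode⊆ m mx with superNode⁻ m
  ... | (v , mv , refl) = proj₁ (comp-∈⁻ mx)

module CollapseOfPeeled {V C : Set} (_≟_ : DecidableEquality V) (K : FG V C) (wf : WF K) where
  private
    module CK = Collapse _≟_ K
    module CJ = Collapse _≟_ (J K)
    module RK = Reachability _≟_ K
    module RJ = Reachability _≟_ (J K)

  low : V → Bool
  low = isLow K

  survivors : List V → List V
  survivors = filterᵇ (not ∘ low)

  single-check : ∀ {x c c′} → low x ≡ true → c ∈ chks K → c′ ∈ chks K →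
    adj K c x ≡ true → adj K c′ x ≡ true → c ≡ c′
  single-check {x} l = count≤1⇒unique (λ c → adj K c x) (≤ᵇ1-true⇒≤1 _ l)

  at-most-two : ∀ {c a b d} → CK.deg2 c ≡ true → a ∈ vars K → b ∈ vars K → d ∈ vars K →
    adj K c a ≡ true → adj K c b ≡ true → adj K c d ≡ true → a ≡ b ⊎ a ≡ d ⊎ b ≡ d
  at-most-two {c} {a} {b} {d} deg2 ma mb md pa pb pd with a ≟ b | a ≟ d | b ≟ d
  ... | yes a≡b | _ | _ = inj₁ a≡b
  ... | no _ | yes a≡d | _ = inj₂ (inj₁ a≡d)
  ... | no _ | no _ | yes b≡d = inj₂ (inj₂ b≡d)
  ... | no a≢b | no a≢d | no b≢d
    with ≡ᵇ2⇒≡2 (chkDeg K c) deg2 | count-≥3 (adj K c) ma mb md a≢b a≢d b≢d pa pb pd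
  ... | deg≡2 | three≤deg rewrite deg≡2 = ⊥-elim (<-irrefl refl three≤deg)

  nonlow≢low : ∀ {a b} → low a ≡ false → low b ≡ true → ¬ a ≡ b
  nonlow≢low la lb refl = clash lb la

  deg2-quiet : ∀ {c u x} → CK.deg2 c ≡ true → u ∈ vars K → x ∈ vars K → ¬ u ≡ x →
    low u ≡ false → low x ≡ false → adj K c u ≡ true → adj K c x ≡ true → hasLowNbr K c ≡ false
  deg2-quiet {c} deg2 mu mx u≢x lu lx au ax = no-low-nbr K nbr-nonlow
    where
    nbr-nonlow : ∀ {y} → y ∈ vars K → adj K c y ≡ true → low y ≡ false
    nbr-nonlow {y} my ay with low y in ly | at-most-two deg2 mu mx my au ax ay
    ... | false | _ = refl
    ... | true | inj₁ u≡x = ⊥-elim (u≢x u≡x)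
    ... | true | inj₂ (inj₁ u≡y) = ⊥-elim (nonlow≢low lu ly u≡y)
    ... | true | inj₂ (inj₂ x≡y) = ⊥-elim (nonlow≢low lx ly x≡y)

  count-survivors : ∀ {c} → hasLowNbr K c ≡ false → (xs : List V) → (∀ {x} → x ∈ xs → x ∈ vars K) →
    count (adj K c) (survivors xs) ≡ count (adj K c) xs
  count-survivors {c} quiet xs xs⊆ = trans (count-filter (adj K c) (not ∘ low) xs)
    (count-cong _ _ xs λ m → drop-nonlow (nbr-not-low K quiet (xs⊆ m)))
    where
    drop-nonlow : ∀ {x} → (adj K c x ≡ true → low x ≡ false) → (not (low x) ∧ adj K c x) ≡ adj K c x
    drop-nonlow {x} g with adj K c x
    ... | true rewrite g refl = refl
    ... | false = ∧-zeroʳ _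

  chkDeg-J : ∀ {c} → hasLowNbr K c ≡ false → chkDeg (J K) c ≡ chkDeg K c
  chkDeg-J quiet = count-survivors quiet (vars K) id

  link-witness : ∀ {u x} → CK.linked u x ≡ true →
    Σ C λ c → (c ∈ chks K) × (CK.deg2 c ≡ true) × (adj K c u ≡ true) × (adj K c x ≡ true)
  link-witness {u} {x} e =
    let (c , mc , q) = any-witness (λ c → CK.deg2 c ∧ (adj K c u ∧ adj K c x)) (chks K) e
        (d , a) = ∧-elim {CK.deg2 c} q ; (au , ax) = ∧-elim {adj K c u} a
    in c , mc , d , au , ax

  linked-J⇒K : ∀ {u w} → CJ.linked u w ≡ true → CK.linked u w ≡ true
  linked-J⇒K {u} {w} e =
    let (c , mc , q) = any-witness (λ c → CJ.deg2 c ∧ (adj K c u ∧ adj K c w)) (chks (J K)) e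
        (mcK , quiet) = J-chk⁻ K mc ; (d , a) = ∧-elim {CJ.deg2 c} q
    in any-intro (λ c → CK.deg2 c ∧ (adj K c u ∧ adj K c w)) mcK
         (∧-intro (subst (λ n → (n ≡ᵇ 2) ≡ true) (chkDeg-J quiet) d) a)

  linked-K⇒J : ∀ {c u x} → c ∈ chks K → hasLowNbr K c ≡ false → CK.deg2 c ≡ true →
    adj K c u ≡ true → adj K c x ≡ true → CJ.linked u x ≡ true
  linked-K⇒J {c} {u} {x} mc quiet deg2 au ax =
    any-intro (λ c → CJ.deg2 c ∧ (adj K c u ∧ adj K c x)) (J-chk⁺ K mc quiet)
      (∧-intro (subst (λ n → (n ≡ᵇ 2) ≡ true) (sym (chkDeg-J quiet)) deg2) (∧-intro au ax))

  reach-J⇒K : ∀ k {v w} → RJ.Reach k v w → RK.Reach k v w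
  reach-J⇒K zero r with RJ.reach-zero r
  ... | refl = RK.reach-refl zero _
  reach-J⇒K (suc k) r with RJ.reach-last r
  ... | inj₁ r₁ = RK.reach-weaken (reach-J⇒K k r₁)
  ... | inj₂ (u , mu , r₁ , l) = RK.reach-extend (reach-J⇒K k r₁) (J-vars⊆ K mu) (linked-J⇒K l)

  -- Peeling does not disconnect non-low variables.  Following a K-path from a non-low
  -- w, every non-low variable met is J K-reachable from w, and every non-low variable
  -- linked to a low one met is J K-reachable too: a low variable sits on a single
  -- degree-2 check, whose other neighbour is the previous variable of the path.
  ReachableJ : V → V → Set
  ReachableJ = RJ.Reachable

  LinksReachableJ : V → V → Set
  LinksReachableJ w x = ∀ {z} → z ∈ vars K → low z ≡ false → CK.linked x z ≡ true → ReachableJ w z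

  Covered : V → V → Set
  Covered w x = (low x ≡ false → ReachableJ w x) × (low x ≡ true → LinksReachableJ w x)

  covered-step : ∀ {w u x} → u ∈ vars K → x ∈ vars K → CK.linked u x ≡ true → Covered w u → Covered w x
  covered-step {w} {u} {x} mu mx l (nonlow-u , low-u) with link-witness l
  ... | (c , mc , deg2 , au , ax) = to-nonlow , to-low
    where
    to-nonlow : low x ≡ false → ReachableJ w x
    to-nonlow lx with low u in lu | u ≟ x
    ... | true | _ = low-u refl mx lx l
    ... | false | yes refl = nonlow-u refl
    ... | false | no u≢x = let (k , r) = nonlow-u refl in
      suc k , RJ.reach-extend r (J-var⁺ K mu lu)
        (linked-K⇒J mc (deg2-quiet deg2 mu mx u≢x lu lx au ax) deg2 au ax)

    to-low : low x ≡ true → LinksReachableJ w x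
    to-low lx {z} mz lz lxz with link-witness lxz
    ... | (c′ , mc′ , _ , ax′ , az) with single-check lx mc′ mc ax′ ax
    ... | refl with at-most-two deg2 mu mx mz au ax az
    ... | inj₁ refl = low-u lx mz lz lxz
    ... | inj₂ (inj₁ refl) = nonlow-u lz
    ... | inj₂ (inj₂ x≡z) = ⊥-elim (nonlow≢low lz lx (sym x≡z))

  covered : ∀ {w} → w ∈ vars K → low w ≡ false → ∀ k {x} → x ∈ vars K → RK.Reach k w x → Covered w x
  covered {w} mw lw zero mx r with RK.reach-zero r
  ... | refl = (λ _ → zero , RJ.reach-refl zero w) , (λ lw′ → ⊥-elim (clash lw′ lw))
  covered mw lw (suc k) mx r with RK.reach-last r
  ... | inj₁ r₁ = covered mw lw k mx r₁
  ... | inj₂ (u , mu , r₁ , l) = covered-step mu mx l (covered mw lw k mu r₁)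

  reach-K≡J : ∀ {w x} → w ∈ vars K → low w ≡ false → x ∈ vars K → low x ≡ false →
    CK.reach (length (vars K)) w x ≡ CJ.reach (length (vars (J K))) w x
  reach-K≡J mw lw mx lx = bool-ext
    (λ e → let (k , r) = proj₁ (covered mw lw (length (vars K)) mx (RK.mkReach e)) lx in
           RJ.reach-true (RJ.reach-stable (J-var⁺ K mw lw) k r))
    (λ e → RK.reach-true (RK.reach-stable mw nJ (reach-J⇒K nJ (RJ.mkReach e))))
    where
    nJ : ℕ
    nJ = length (vars (J K))

  survivors-comp : ∀ {w} → w ∈ vars K → low w ≡ false → survivors (CK.comp w) ≡ CJ.comp w
  survivors-comp {w} mw lw = begin
    survivors (CK.comp w)
      ≡⟨ filter-filter (not ∘ low) (CK.reach nK w) (vars K) ⟩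
    filterᵇ (λ x → CK.reach nK w x ∧ not (low x)) (vars K)
      ≡⟨ filter-cong _ _ (vars K) same-test ⟩
    filterᵇ (λ x → not (low x) ∧ CJ.reach nJ w x) (vars K)
      ≡⟨ filter-filter (CJ.reach nJ w) (not ∘ low) (vars K) ⟨
    CJ.comp w ∎
    where
    open ≡-Reasoning
    nK nJ : ℕ
    nK = length (vars K)
    nJ = length (vars (J K))
    same-test : ∀ {x} → x ∈ vars K → (CK.reach nK w x ∧ not (low x)) ≡ (not (low x) ∧ CJ.reach nJ w x)
    same-test {x} mx with low x in lx
    ... | true = ∧-zeroʳ _
    ... | false = trans (∧-identityʳ _) (reach-K≡J mw lw mx lx)

  H : FG (List V) C
  H = Tcol _≟_ K

  H′ : FG (List V) C
  H′ = Tcol _≟_ (J K)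

  heavy heavyJ : C → Bool
  heavy c = 3 ≤ᵇ chkDeg K c
  heavyJ c = 3 ≤ᵇ chkDeg (J K) c

  -- A low variable on a heavy check is not linked to anything: its only check is heavy.
  low-on-heavy-unlinked : ∀ {u c c′} → low u ≡ true → c ∈ chks K → heavy c ≡ true → adj K c u ≡ true →
    c′ ∈ chks K → CK.deg2 c′ ≡ true → adj K c′ u ≡ true → ⊥
  low-on-heavy-unlinked lu mc hc ac mc′ deg2 ac′ with single-check lu mc′ mc ac′ ac
  ... | refl = heavy⇒not-deg2 (chkDeg K _) hc deg2

  no-link-into : ∀ {u c} → low u ≡ true → c ∈ chks K → heavy c ≡ true → adj K c u ≡ true →
    ∀ z → CK.linked z u ≡ false
  no-link-into {u} lu mc hc ac z with CK.linked z u in e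
  ... | false = refl
  ... | true = let (c′ , mc′ , deg2 , _ , ac′) = link-witness e in
    ⊥-elim (low-on-heavy-unlinked lu mc hc ac mc′ deg2 ac′)

  no-link-out : ∀ {u c} → low u ≡ true → c ∈ chks K → heavy c ≡ true → adj K c u ≡ true →
    ∀ z → CK.linked u z ≡ false
  no-link-out {u} lu mc hc ac z with CK.linked u z in e
  ... | false = refl
  ... | true = let (c′ , mc′ , deg2 , ac′ , _) = link-witness e in
    ⊥-elim (low-on-heavy-unlinked lu mc hc ac mc′ deg2 ac′)

  -- A super-node consisting of low variables is low in T K: each heavy check
  -- meeting it meets it in an isolated variable, i.e. at v itself.
  all-low⇒low : ∀ {v} → v ∈ vars K → (∀ {x} → x ∈ CK.comp v → low x ≡ true) → isLow H (CK.comp v) ≡ true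
  all-low⇒low {v} mv all-low with isLow H (CK.comp v) in e
  ... | true = refl
  ... | false =
    let (_ , _ , m₁ , m₂ , c₁≢c₂ , a₁ , a₂) = count-≥2⁻ (λ c → adj H c (CK.comp v)) (chks H)
                                                  (Unique.filter⁺ _ (proj₂ wf)) (≤ᵇ1-false⇒2≤ _ e)
    in ⊥-elim (c₁≢c₂ (single-check (all-low (RK.comp-∋-self mv))
                        (checks⊆ m₁) (checks⊆ m₂) (meets-at-v m₁ a₁) (meets-at-v m₂ a₂)))
    where
    checks⊆ : ∀ {c} → c ∈ chks H → c ∈ chks K
    checks⊆ = proj₁ ∘ ∈-filterᵇ⁻ heavy

    meets-at-v : ∀ {c} → c ∈ chks H → adj H c (CK.comp v) ≡ true → adj K c v ≡ true
    meets-at-v {c} m a =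
      let (mc , hc) = ∈-filterᵇ⁻ heavy m
          (_ , mu , au) = count-≥1⁻ (adj K c) (CK.comp v) (odd⇒pos _ a)
          u≡v = RK.isolated-target (no-link-into (all-low mu) mc hc au) _ (proj₂ (RK.comp-∈⁻ mu))
      in subst (λ y → adj K c y ≡ true) (sym u≡v) au

  -- Checks surviving in J (T K) have no low neighbour in K: a low neighbour would be
  -- an isolated variable forming a low singleton super-node joined to the check.
  peeled-collapse-chk-quiet : ∀ {c} → c ∈ chks (J H) → hasLowNbr K c ≡ false
  peeled-collapse-chk-quiet {c} m with hasLowNbr K c in e
  ... | false = refl
  ... | true =
    let (mcH , quietH) = J-chk⁻ H m
        (mc , hc) = ∈-filterᵇ⁻ heavy mcH
        (u , mu , q) = any-witness (λ v → adj K c v ∧ low v) (vars K) e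
        (ac , lu) = ∧-elim {adj K c u} q
        only-u : ∀ {x} → x ∈ vars K → CK.reach (length (vars K)) u x ≡ true → x ≡ u
        only-u _ r = RK.isolated-source (no-link-out lu mc hc ac) (length (vars K)) (RK.mkReach r)
        comp-low = all-low⇒low mu (λ mx → subst (λ y → low y ≡ true) (sym (only-u (proj₁ (RK.comp-∈⁻ mx))
                                                  (RK.reach-true (proj₂ (RK.comp-∈⁻ mx))))) lu)
        joined : adj H c (CK.comp u) ≡ true
        joined = cong (λ k → k % 2 ≡ᵇ 1) (count-filter-single (CK.reach (length (vars K)) u) (adj K c)
                   (proj₁ wf) mu (RK.reach-true (RK.reach-refl (length (vars K)) u)) only-u ac)
    in ⊥-elim (clash comp-low (nbr-not-low H quietH (RK.superNode⁺ mu) joined))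

  survivors-adj : ∀ {c S} → hasLowNbr K c ≡ false → S ∈ vars H → adj H′ c (survivors S) ≡ adj H c S
  survivors-adj quiet m = cong (λ k → k % 2 ≡ᵇ 1) (count-survivors quiet _ (RK.superNode⊆ m))

  survivors-deg : ∀ {S} → S ∈ vars H → varDeg H′ (survivors S) ≤ varDeg H S
  survivors-deg {S} m = begin
    varDeg H′ (survivors S)
      ≡⟨ count-filter (λ c → adj H′ c (survivors S)) heavyJ (chks (J K)) ⟩
    count (λ c → heavyJ c ∧ adj H′ c (survivors S)) (chks (J K))
      ≡⟨ count-filter _ (not ∘ hasLowNbr K) (chks K) ⟩
    count (λ c → not (hasLowNbr K c) ∧ (heavyJ c ∧ adj H′ c (survivors S))) (chks K)
      ≤⟨ count-mono _ _ (chks K) (λ _ → in-T-K) ⟩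
    count (λ c → heavy c ∧ adj H c S) (chks K)
      ≡⟨ count-filter (λ c → adj H c S) heavy (chks K) ⟨
    varDeg H S ∎
    where
    open ≤-Reasoning
    in-T-K : ∀ {c} → (not (hasLowNbr K c) ∧ (heavyJ c ∧ adj H′ c (survivors S))) ≡ true → (heavy c ∧ adj H c S) ≡ true
    in-T-K {c} e = let (nq , q) = ∧-elim {not (hasLowNbr K c)} e ; quiet = not-elim nq in
      subst (_≡ true) (cong₂ _∧_ (cong (3 ≤ᵇ_) (chkDeg-J quiet)) (survivors-adj quiet m)) q

  survivors-nonlow : ∀ {S} → S ∈ vars H → isLow H′ (survivors S) ≡ false → isLow H S ≡ false
  survivors-nonlow m l = 2≤⇒≤ᵇ1-false _ (≤-trans (≤ᵇ1-false⇒2≤ _ l) (survivors-deg m))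

  superNode-cases : ∀ {S} → S ∈ vars H →
    (∀ {x} → x ∈ S → low x ≡ true) ⊎ (Σ V λ w → (w ∈ vars K) × (low w ≡ false) × (S ≡ CK.comp w))
  superNode-cases m with RK.superNode⁻ m
  ... | (v , mv , refl) with any (not ∘ low) (CK.comp v) in e
  ... | false = inj₁ λ mx → not-injective (any-false-elim (not ∘ low) e mx)
  ... | true = let (w , mw , q) = any-witness (not ∘ low) (CK.comp v) e
                   (mwK , r) = RK.comp-∈⁻ mw in
    inj₂ (w , mwK , not-elim q , RK.comp-≡ mv mwK r)

  survivors-superNode : ∀ {w} → w ∈ vars K → low w ≡ false → survivors (CK.comp w) ∈ vars H′
  survivors-superNode mw lw = subst (_∈ vars H′) (sym (survivors-comp mw lw)) (RJ.superNode⁺ (J-var⁺ K mw lw))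

  superNode′-preimage : ∀ {S′} → S′ ∈ vars H′ → Σ V λ w → (CK.comp w ∈ vars H) × (survivors (CK.comp w) ≡ S′)
  superNode′-preimage mS′ with RJ.superNode⁻ mS′
  ... | (w , mwJ , refl) = let (mw , lw) = J-var⁻ K mwJ in
    w , RK.superNode⁺ mw , survivors-comp mw lw

  sim-var-map : ∀ {S} → S ∈ vars (J H) → survivors S ∈ vars H′
  sim-var-map m with J-var⁻ H m
  ... | (mS , lS) with superNode-cases mS
  ... | inj₁ all-low with RK.superNode⁻ mS
  ...   | (v , mv , refl) = ⊥-elim (clash (all-low⇒low mv all-low) lS)
  sim-var-map m | (mS , lS) | inj₂ (w , mw , lw , refl) = survivors-superNode mw lw

  sim-chk-incl : ∀ {c} → c ∈ chks (J H) → c ∈ chks H′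
  sim-chk-incl {c} m = let quiet = peeled-collapse-chk-quiet m
                           (mc , hc) = ∈-filterᵇ⁻ heavy (J-chks⊆ H m) in
    ∈-filterᵇ⁺ heavyJ (J-chk⁺ K mc quiet) (subst (λ k → (3 ≤ᵇ k) ≡ true) (sym (chkDeg-J quiet)) hc)

  sim-adj-pres : ∀ {c S} → c ∈ chks (J H) → S ∈ vars (J H) → adj (J H) c S ≡ adj H′ c (survivors S)
  sim-adj-pres mc mS = sym (survivors-adj (peeled-collapse-chk-quiet mc) (J-vars⊆ H mS))

  sim-nbr-image : ∀ {c S′} → c ∈ chks (J H) → S′ ∈ vars H′ → adj H′ c S′ ≡ true →
    Σ (List V) λ S → (S ∈ vars (J H)) × (survivors S ≡ S′)
  sim-nbr-image {c} mc mS′ a with superNode′-preimage mS′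
  ... | (w , mS , refl) =
    CK.comp w , J-var⁺ H mS (nbr-not-low H (proj₂ (J-chk⁻ H mc)) mS
                               (trans (sym (survivors-adj (peeled-collapse-chk-quiet mc) mS)) a)) , refl

  sim-nonlow-image : ∀ {S′} → S′ ∈ vars H′ → isLow H′ S′ ≡ false →
    Σ (List V) λ S → (S ∈ vars (J H)) × (survivors S ≡ S′)
  sim-nonlow-image mS′ l with superNode′-preimage mS′
  ... | (w , mS , refl) = CK.comp w , J-var⁺ H mS (survivors-nonlow mS l) , refl

  -- A check of T (J K) without low neighbours has none in T K either: a super-node of
  -- low variables joined to it would give it a low neighbour in K, and otherwise the
  -- survivors of the super-node are a non-low neighbour in T (J K).
  sim-quiet-chk-incl : ∀ {c} → c ∈ chks H′ → hasLowNbr H′ c ≡ false → c ∈ chks (J H)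
  sim-quiet-chk-incl {c} m quietH′ =
    let (mcJ , hJ) = ∈-filterᵇ⁻ heavyJ m
        (mc , quiet) = J-chk⁻ K mcJ
    in J-chk⁺ H (∈-filterᵇ⁺ heavy mc (subst (λ k → (3 ≤ᵇ k) ≡ true) (chkDeg-J quiet) hJ))
                (no-low-nbr H (nbr-nonlow quiet))
    where
    nbr-nonlow : hasLowNbr K c ≡ false → ∀ {S} → S ∈ vars H → adj H c S ≡ true → isLow H S ≡ false
    nbr-nonlow quiet {S} mS a with superNode-cases mS
    ... | inj₁ all-low =
      let (_ , mu , au) = count-≥1⁻ (adj K c) S (odd⇒pos _ a) in
      ⊥-elim (clash (all-low mu) (nbr-not-low K quiet (RK.superNode⊆ mS mu) au))
    ... | inj₂ (w , mw , lw , refl) =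
      survivors-nonlow mS (nbr-not-low H′ quietH′ (survivors-superNode mw lw) (trans (survivors-adj quiet mS) a))

  simulation : Simulation (J H) H′ survivors
  simulation = record
    { chksA-unique = J-chks-unique H (Unique.filter⁺ _ (proj₂ wf))
    ; chksB-unique = Unique.filter⁺ _ (J-chks-unique K (proj₂ wf))
    ; var-map = sim-var-map
    ; chk-incl = sim-chk-incl
    ; adj-pres = sim-adj-pres
    ; nbr-image = sim-nbr-image
    ; nonlow-image = sim-nonlow-image
    ; quiet-chk-incl = sim-quiet-chk-incl
    }

TC-collapse-J : {V C : Set} (_≟_ : DecidableEquality V) (K : FG V C) → WF K →
  TC (Tcol _≟_ K) ≤ suc (TC (Tcol _≟_ (J K)))
TC-collapse-J _≟_ K wf = TC-step (Tcol _≟_ K) (Tcol _≟_ (J K)) _ (CollapseOfPeeled.simulation _≟_ K wf)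

WF-Jpow : {V C : Set} (t : ℕ) {G : FG V C} → WF G → WF (Jpow t G)
WF-Jpow zero wf = wf
WF-Jpow (suc t) wf = let (uV , uC) = WF-Jpow t wf in Unique.filter⁺ _ uV , Unique.filter⁺ _ uC

lemma5p1 : {V C : Set} (_≟_ : DecidableEquality V) (τ : ℕ) (G : FG V C) →
    WF G → Peelable G →
    TC (Tcol _≟_ G) ≤ TC (Tcol _≟_ (Jpow τ G)) + τ
lemma5p1 _≟_ zero G wf _ = ≤-reflexive (sym (+-identityʳ _))
lemma5p1 _≟_ (suc τ) G wf peelable = begin
  TC (Tcol _≟_ G)                       ≤⟨ lemma5p1 _≟_ τ G wf peelable ⟩
  TC (Tcol _≟_ (Jpow τ G)) + τ          ≤⟨ +-monoˡ-≤ τ (TC-collapse-J _≟_ (Jpow τ G) (WF-Jpow τ wf)) ⟩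
  suc (TC (Tcol _≟_ (Jpow (suc τ) G))) + τ ≡⟨ +-suc _ τ ⟨
  TC (Tcol _≟_ (Jpow (suc τ) G)) + suc τ ∎
  where open ≤-Reasoning
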